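{- Let $A$ be a finite abelian group of even order and $H$ a subgroup of $A$. The following are equivalent: (i) $H$ is a subgroup perfect code of $A$; (ii) there is a square-free subset $T\subseteq A$ such that $T^0=T\cup\{0\}$ is a transversal of $H$ in $A$; (iii) there is a square-free subset $T\subseteq A$ such that $[A:H]=|T|+1$ and $H\cap(T\cup(T-T))=\{0\}$; (iv) there is a square-free subset $T\subseteq A$ such that $A=H\oplus T^0$, where $T^0=T\cup\{0\}$; (v) $H$ is a subgroup perfect code of every subgroup of $A$ that contains $H$.
   Context: Groups are written additively. For an abelian group $B$, an element $x\in B$ is a square if $x=2y$ for some $y\in B$; a subset is square-free if it contains no squares. For a square-free $T\subseteq B$, $\mathrm{CayS}(B,T)$ is the simple graph with vertex set $B$ where distinct $x,y$ are adjacent iff $x+y\in T$. A subset $C$ of vertices of a graph is a perfect code if every vertex is at distance at most one from exactly one vertex of $C$. A subgroup $H$ of $B$ is a subgroup perfect code of $B$ if $H$ is a perfect code of $\mathrm{CayS}(B,T)$ for some square-free $T\subseteq B$. A transversal of $H$ in $A$ is a subset containing exactly one element of each coset of $H$. For $M,N\subseteq A$, $A=M\oplus N$ means every $a\in A$ can be written uniquely as $m+n$ with $m\in M,n\in N$; $T-T=\{t-t':t,t'\in T\}$. -}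

module Defs where

open import Data.Nat using (ℕ; _+_; _*_)
open import Data.Fin using (Fin)
open import Data.Fin.Subset using (Subset; _∈_; _∉_; _⊆_; _∪_; ⁅_⁆; ⊤; ∣_∣)
open import Data.Product using (Σ; ∃; _×_; _,_)
open import Data.Sum using (_⊎_)
open import Relation.Nullary using (¬_)
open import Relation.Binary.PropositionalEquality using (_≡_; _≢_)
open import Algebra.Structures using (IsAbelianGroup)

-- A finite abelian group of order n, presented with carrier Fin n
-- (every finite abelian group of order n is isomorphic to one of these).
record FinAbGroup (n : ℕ) : Set where
  infixl 6 _⊕_
  field
    _⊕_ : Fin n → Fin n → Fin n
    𝟘 : Fin n
    ⊝_ : Fin n → Fin n
    isAbelianGroup : IsAbelianGroup _≡_ _⊕_ 𝟘 ⊝_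

  _⊖_ : Fin n → Fin n → Fin n
  x ⊖ y = x ⊕ (⊝ y)

module _ {n : ℕ} (G : FinAbGroup n) where
  open FinAbGroup G

  record IsSubgroup (H : Subset n) : Set where
    field
      zero-mem : 𝟘 ∈ H
      add-mem  : ∀ {x y} → x ∈ H → y ∈ H → (x ⊕ y) ∈ H
      neg-mem  : ∀ {x} → x ∈ H → (⊝ x) ∈ H

  IsSquareIn : Subset n → Fin n → Set
  IsSquareIn B x = Σ (Fin n) λ y → y ∈ B × x ≡ y ⊕ y

  SquareFreeIn : Subset n → Subset n → Set
  SquareFreeIn B T = ∀ x → x ∈ T → ¬ IsSquareIn B x

  SquareFree : Subset n → Set
  SquareFree T = SquareFreeIn ⊤ T

  -- adjacency in CayS(B,T) (vertices are elements of B)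
  CayAdj : Subset n → Fin n → Fin n → Set
  CayAdj T x y = x ≢ y × (x ⊕ y) ∈ T

  Dist≤1 : Subset n → Fin n → Fin n → Set
  Dist≤1 T v c = c ≡ v ⊎ CayAdj T v c

  IsPerfectCodeCayS : Subset n → Subset n → Subset n → Set
  IsPerfectCodeCayS B T C =
    ∀ v → v ∈ B →
      Σ (Fin n) λ c → c ∈ C × Dist≤1 T v c ×
        (∀ c′ → c′ ∈ C → Dist≤1 T v c′ → c′ ≡ c)

  SubgroupPerfectCodeOf : Subset n → Subset n → Set
  SubgroupPerfectCodeOf B H =
    Σ (Subset n) λ T → T ⊆ B × SquareFreeIn B T × IsPerfectCodeCayS B T H

  SubgroupPerfectCode : Subset n → Set
  SubgroupPerfectCode H = SubgroupPerfectCodeOf ⊤ H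

  T⁰ : Subset n → Subset n
  T⁰ T = T ∪ ⁅ 𝟘 ⁆

  IsTransversal : Subset n → Subset n → Set
  IsTransversal H S =
    ∀ a → Σ (Fin n) λ s → s ∈ S × (s ⊖ a) ∈ H ×
            (∀ s′ → s′ ∈ S → (s′ ⊖ a) ∈ H → s′ ≡ s)

  InDiff : Subset n → Fin n → Set
  InDiff T x = Σ (Fin n) λ t → Σ (Fin n) λ t′ → t ∈ T × t′ ∈ T × x ≡ t ⊖ t′

  IndexIs : Subset n → ℕ → Set
  IndexIs H k = n ≡ ∣ H ∣ * k

  DirectDecomp : Subset n → Subset n → Set
  DirectDecomp M N =
    ∀ a → Σ (Fin n) λ m → Σ (Fin n) λ k → m ∈ M × k ∈ N × a ≡ m ⊕ k ×
      (∀ m′ k′ → m′ ∈ M → k′ ∈ N → a ≡ m′ ⊕ k′ → m′ ≡ m × k′ ≡ k)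

module Submission where

-- Everything is routed through one intermediate notion: a square-free T such
-- that T⁰ = T ∪ {0} is SEPARATED (distinct elements of T⁰ lie in distinct
-- cosets of H) and COVERS A (every coset of H meets T⁰).
--   * transversals and direct decompositions A = H ⊕ S are both exactly the
--     separated covering sets S (for arbitrary S);
--   * the sum map H × S → A is injective iff S is separated and onto iff S
--     covers, so by counting a separated S covers iff |A| = |H|·|S|; for
--     S = T⁰ separation is the condition H ∩ (T ∪ (T − T)) = {0} and
--     |T⁰| = |T| + 1 since 0 is not a square;
--   * in CayS(B, T ∩ B) the vertex v is dominated by c ∈ H iff c = v or
--     v + c ∈ T, i.e. iff v + c or 0 is the element of T⁰ in the coset of v;
--     so T⁰ is a separated covering set iff H is a perfect code, and this is
--     inherited by every subgroup B ⊇ H.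

open import Defs
open import Data.Nat using (ℕ; zero; suc; _+_; _*_)
open import Data.Nat.Properties using (1+n≰n; +-comm)
open import Data.Nat.Divisibility using (_∣_)
open import Data.Fin using (Fin; zero; suc; _≟_; punchOut)
open import Data.Fin.Properties using (any?; injective⇒≤; punchOut-injective; *↔×; cantor-schröder-bernstein)
open import Data.Fin.Subset using (Subset; _∈_; _∉_; _⊆_; _∪_; _∩_; ⁅_⁆; ⊤; ∣_∣; inside; outside)
open import Data.Fin.Subset.Properties using (∪-identityʳ; x∈p∪q⁻; x∈p∪q⁺; x∈⁅x⁆; x∈⁅y⁆⇒x≡y; ∈⊤; x∈p∩q⁺; x∈p∩q⁻)
open import Data.Vec.Base using (_∷_; here; there)
open import Data.Vec.Properties.WithK using ([]=-irrelevant)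
open import Data.Product using (Σ; _×_; _,_; proj₁; proj₂)
open import Data.Product.Function.NonDependent.Propositional using (_×-↔_; _×-⇔_)
open import Data.Product.Function.Dependent.Propositional using (Σ-⇔)
open import Data.Sum using (_⊎_; inj₁; inj₂)
open import Relation.Nullary using (yes; no; contradiction)
open import Relation.Binary.PropositionalEquality using (_≡_; _≢_; refl; sym; trans; cong; cong₂; subst; module ≡-Reasoning)
open import Function.Base using (_∘_)
open import Function.Bundles using (_↔_; _⇔_; mk↔ₛ′; mk⇔; Equivalence; Inverse; Injection)
open import Function.Definitions using (Injective; StrictlySurjective)
open import Function.Properties.Inverse using (↔-trans; ↔-sym; ↔⇒↣)
open import Function.Construct.Identity using (⇔-id; ↠-id)
open import Function.Construct.Symmetry using (⇔-sym)
open import Function.Construct.Composition using (_⇔-∘_)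
open import Algebra.Bundles using (AbelianGroup)
open import Algebra.Structures using (IsAbelianGroup)
import Algebra.Properties.AbelianGroup as AbelianGroupProperties

Elem : ∀ {n} → Subset n → Set
Elem {n} p = Σ (Fin n) (_∈ p)

-- Membership proofs are unique, so elements of a subset are determined by
-- their underlying element of Fin n.
Elem-≡ : ∀ {n} {p : Subset n} {x y : Fin n} {x∈p : x ∈ p} {y∈p : y ∈ p} →
         x ≡ y → _≡_ {A = Elem p} (x , x∈p) (y , y∈p)
Elem-≡ {x∈p = x∈p} {y∈p} refl = cong (_ ,_) ([]=-irrelevant x∈p y∈p)

sucElem : ∀ {n b} {p : Subset n} → Elem p → Elem (b ∷ p)
sucElem (x , x∈p) = suc x , there x∈p

nth : ∀ {n} (p : Subset n) → Fin ∣ p ∣ → Elem p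
nth (inside  ∷ p) zero    = zero , here
nth (inside  ∷ p) (suc i) = sucElem (nth p i)
nth (outside ∷ p) i       = sucElem (nth p i)

index : ∀ {n} (p : Subset n) {x : Fin n} → x ∈ p → Fin ∣ p ∣
index (inside  ∷ p) here        = zero
index (inside  ∷ p) (there x∈p) = suc (index p x∈p)
index (outside ∷ p) (there x∈p) = index p x∈p

index-nth : ∀ {n} (p : Subset n) i → index p (proj₂ (nth p i)) ≡ i
index-nth (inside  ∷ p) zero    = refl
index-nth (inside  ∷ p) (suc i) = cong suc (index-nth p i)
index-nth (outside ∷ p) i       = index-nth p i

nth-index : ∀ {n} (p : Subset n) {x} (x∈p : x ∈ p) → nth p (index p x∈p) ≡ (x , x∈p)
nth-index (inside  ∷ p) here        = refl
nth-index (inside  ∷ p) (there x∈p) = cong sucElem (nth-index p x∈p)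
nth-index (outside ∷ p) (there x∈p) = cong sucElem (nth-index p x∈p)

Fin∣p∣↔Elem : ∀ {n} (p : Subset n) → Fin ∣ p ∣ ↔ Elem p
Fin∣p∣↔Elem p = mk↔ₛ′ (nth p) (λ (_ , x∈p) → index p x∈p)
  (λ (_ , x∈p) → nth-index p x∈p) (index-nth p)

∣p∪⁅x⁆∣ : ∀ {n} (p : Subset n) {x} → x ∉ p → ∣ p ∪ ⁅ x ⁆ ∣ ≡ suc ∣ p ∣
∣p∪⁅x⁆∣ (inside  ∷ p) {zero}  x∉p = contradiction here x∉p
∣p∪⁅x⁆∣ (outside ∷ p) {zero}  x∉p = cong suc (cong ∣_∣ (∪-identityʳ p))
∣p∪⁅x⁆∣ (inside  ∷ p) {suc x} x∉p = cong suc (∣p∪⁅x⁆∣ p (x∉p ∘ there))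
∣p∪⁅x⁆∣ (outside ∷ p) {suc x} x∉p = ∣p∪⁅x⁆∣ p (x∉p ∘ there)

injective⇒surjective : ∀ {m k} → m ≡ k → (f : Fin m → Fin k) →
                       Injective _≡_ _≡_ f → StrictlySurjective _≡_ f
injective⇒surjective {zero}  refl f f-inj ()
injective⇒surjective {suc _} refl f f-inj y with any? (λ x → f x ≟ y)
... | yes hit = hit
... | no miss = contradiction (injective⇒≤ g-inj) 1+n≰n
  where
  g : Fin _ → Fin _
  g x = punchOut {i = y} {j = f x} (λ e → miss (x , sym e))
  g-inj : Injective _≡_ _≡_ g
  g-inj = f-inj ∘ punchOut-injective {i = y} _ _

module GroupFacts {n : ℕ} (G : FinAbGroup n) where
  open FinAbGroup G public
  open IsAbelianGroup isAbelianGroup public using (assoc; comm; identityˡ; identityʳ; inverseʳ)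

  abelianGroup : AbelianGroup _ _
  abelianGroup = record { isAbelianGroup = isAbelianGroup }

  -- x ⊖ y is x // y in the library's notation, so its laws apply verbatim:
  -- (x // y) ∙ y ≈ x,  (y ∙ x) // x ≈ y,  x ∙ y ∙ x ⁻¹ ≈ y, ...
  open AbelianGroupProperties abelianGroup public
    using (//-rightDividesˡ; //-rightDividesʳ; \\-leftDividesʳ; xyx⁻¹≈y; ⁻¹-anti-homo‿-; x∙y⁻¹≈ε⇒x≈y; ε⁻¹≈ε)

  x⊕[y⊖x]≡y : ∀ x y → x ⊕ (y ⊖ x) ≡ y
  x⊕[y⊖x]≡y x y = trans (comm x (y ⊖ x)) (//-rightDividesˡ x y)

  x⊖𝟘≡x : ∀ x → x ⊖ 𝟘 ≡ x
  x⊖𝟘≡x x = trans (cong (x ⊕_) ε⁻¹≈ε) (identityʳ x)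

  ⊕-cancelˡ : ∀ x {y z} → x ⊕ y ≡ x ⊕ z → y ≡ z
  ⊕-cancelˡ x {y} {z} e = begin
    y                ≡⟨ sym (xyx⁻¹≈y x y) ⟩
    (x ⊕ y) ⊖ x      ≡⟨ cong (_⊖ x) e ⟩
    (x ⊕ z) ⊖ x      ≡⟨ xyx⁻¹≈y x z ⟩
    z                ∎
    where open ≡-Reasoning

  𝟘∉ : ∀ {T} → SquareFree G T → 𝟘 ∉ T
  𝟘∉ sf 𝟘∈T = sf 𝟘 𝟘∈T (𝟘 , ∈⊤ , sym (identityˡ 𝟘))

  x⊕x∉ : ∀ {T} → SquareFree G T → ∀ x → (x ⊕ x) ∉ T
  x⊕x∉ sf x x⊕x∈T = sf (x ⊕ x) x⊕x∈T (x , ∈⊤ , refl)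

  T⁰-cases : ∀ {T x} → x ∈ T⁰ G T → x ∈ T ⊎ x ≡ 𝟘
  T⁰-cases {T} x∈T⁰ with x∈p∪q⁻ T ⁅ 𝟘 ⁆ x∈T⁰
  ... | inj₁ x∈T  = inj₁ x∈T
  ... | inj₂ x∈𝟘 = inj₂ (x∈⁅y⁆⇒x≡y 𝟘 x∈𝟘)

  T⊆T⁰ : ∀ {T x} → x ∈ T → x ∈ T⁰ G T
  T⊆T⁰ x∈T = x∈p∪q⁺ (inj₁ x∈T)

  𝟘∈T⁰ : ∀ {T} → 𝟘 ∈ T⁰ G T
  𝟘∈T⁰ = x∈p∪q⁺ (inj₂ (x∈⁅x⁆ 𝟘))

  ∣T⁰∣ : ∀ {T} → SquareFree G T → ∣ T⁰ G T ∣ ≡ ∣ T ∣ + 1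
  ∣T⁰∣ {T} sf = trans (∣p∪⁅x⁆∣ T (𝟘∉ sf)) (+-comm 1 ∣ T ∣)

  adjacent : ∀ {T v c} → SquareFree G T → (v ⊕ c) ∈ T → Dist≤1 G T v c
  adjacent {T} {v} sf v⊕c∈T = inj₂ (v≢c , v⊕c∈T)
    where
    v≢c : v ≢ _
    v≢c refl = x⊕x∉ sf v v⊕c∈T

module Cosets {n : ℕ} (G : FinAbGroup n) (H : Subset n) (H≤A : IsSubgroup G H) where
  open GroupFacts G
  open IsSubgroup H≤A

  infix 4 _∼_
  _∼_ : Fin n → Fin n → Set
  x ∼ y = (x ⊖ y) ∈ H

  ∼-refl : ∀ x → x ∼ x
  ∼-refl x = subst (_∈ H) (sym (inverseʳ x)) zero-mem

  ∼-sym : ∀ {x y} → x ∼ y → y ∼ x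
  ∼-sym {x} {y} x∼y = subst (_∈ H) (⁻¹-anti-homo‿- x y) (neg-mem x∼y)

  ∼-trans : ∀ {x y z} → x ∼ y → y ∼ z → x ∼ z
  ∼-trans {x} {y} {z} x∼y y∼z = subst (_∈ H) telescope (add-mem x∼y y∼z)
    where
    telescope : (x ⊖ y) ⊕ (y ⊖ z) ≡ x ⊖ z
    telescope = trans (assoc x (⊝ y) (y ⊖ z)) (cong (x ⊕_) (\\-leftDividesʳ y (⊝ z)))

  ∈H⇒∼𝟘 : ∀ {x} → x ∈ H → x ∼ 𝟘
  ∈H⇒∼𝟘 {x} = subst (_∈ H) (sym (x⊖𝟘≡x x))

  ∼𝟘⇒∈H : ∀ {x} → x ∼ 𝟘 → x ∈ H
  ∼𝟘⇒∈H {x} = subst (_∈ H) (x⊖𝟘≡x x)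

  h⊕x∼x : ∀ {h} x → h ∈ H → h ⊕ x ∼ x
  h⊕x∼x {h} x = subst (_∈ H) (sym (//-rightDividesʳ x h))

  x⊕h∼x : ∀ x {h} → h ∈ H → x ⊕ h ∼ x
  x⊕h∼x x {h} = subst (_∈ H) (sym (xyx⁻¹≈y x h))

  Separated : Subset n → Set
  Separated S = ∀ {s s′} → s ∈ S → s′ ∈ S → s ∼ s′ → s ≡ s′

  Covers : Subset n → Set
  Covers S = ∀ a → Σ (Fin n) λ s → s ∈ S × s ∼ a

  transversal⇔separated×covers : ∀ {S} → IsTransversal G H S ⇔ (Separated S × Covers S)
  transversal⇔separated×covers {S} = mk⇔ (λ tr → (λ {_} {_} → separated tr) , covers tr) transversal
    where
    separated : IsTransversal G H S → Separated S
    separated tr {s} {s′} s∈S s′∈S s∼s′ with tr s′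
    ... | _ , _ , _ , unique = trans (unique s s∈S s∼s′) (sym (unique s′ s′∈S (∼-refl s′)))
    covers : IsTransversal G H S → Covers S
    covers tr a with tr a
    ... | s , s∈S , s∼a , _ = s , s∈S , s∼a
    transversal : Separated S × Covers S → IsTransversal G H S
    transversal (sep , cov) a with cov a
    ... | s , s∈S , s∼a = s , s∈S , s∼a , λ s′ s′∈S s′∼a → sep s′∈S s∈S (∼-trans s′∼a (∼-sym s∼a))

  unique-sum : ∀ {S} → Separated S → ∀ {m k m′ k′} → m ∈ H → k ∈ S → m′ ∈ H → k′ ∈ S →
               m ⊕ k ≡ m′ ⊕ k′ → m ≡ m′ × k ≡ k′
  unique-sum sep {m} {k} {m′} {k′} m∈H k∈S m′∈H k′∈S e = m≡m′ , k≡k′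
    where
    k∼k′ : k ∼ k′
    k∼k′ = ∼-trans (∼-sym (h⊕x∼x k m∈H)) (subst (_∼ k′) (sym e) (h⊕x∼x k′ m′∈H))
    k≡k′ : k ≡ k′
    k≡k′ = sep k∈S k′∈S k∼k′
    m≡m′ : m ≡ m′
    m≡m′ = begin
      m              ≡⟨ sym (//-rightDividesʳ k m) ⟩
      (m ⊕ k) ⊖ k    ≡⟨ cong₂ _⊖_ e k≡k′ ⟩
      (m′ ⊕ k′) ⊖ k′ ≡⟨ //-rightDividesʳ k′ m′ ⟩
      m′             ∎
      where open ≡-Reasoning

  decomposition⇔separated×covers : ∀ {S} → DirectDecomp G H S ⇔ (Separated S × Covers S)
  decomposition⇔separated×covers {S} = mk⇔ (λ dd → (λ {_} {_} → separated dd) , covers dd) decomposition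
    where
    separated : DirectDecomp G H S → Separated S
    separated dd {s} {s′} s∈S s′∈S s∼s′ with dd s
    ... | _ , _ , _ , _ , _ , unique =
      trans (proj₂ (unique 𝟘 s zero-mem s∈S (sym (identityˡ s))))
            (sym (proj₂ (unique (s ⊖ s′) s′ s∼s′ s′∈S (sym (//-rightDividesˡ s′ s)))))
    covers : DirectDecomp G H S → Covers S
    covers dd a with dd a
    ... | m , k , m∈H , k∈S , a≡m⊕k , _ = k , k∈S , subst (k ∼_) (sym a≡m⊕k) (∼-sym (h⊕x∼x k m∈H))
    decomposition : Separated S × Covers S → DirectDecomp G H S
    decomposition (sep , cov) a with cov a
    ... | s , s∈S , s∼a =
      a ⊖ s , s , ∼-sym s∼a , s∈S , sym (//-rightDividesˡ s a) ,
      λ m′ k′ m′∈H k′∈S a≡m′⊕k′ →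
        unique-sum sep m′∈H k′∈S (∼-sym s∼a) s∈S (trans (sym a≡m′⊕k′) (sym (//-rightDividesˡ s a)))

  Pairs : Subset n → Set
  Pairs S = Elem H × Elem S

  sum : ∀ {S} → Pairs S → Fin n
  sum ((h , _) , (s , _)) = h ⊕ s

  sum-injective : ∀ {S} → Separated S → Injective _≡_ _≡_ (sum {S})
  sum-injective sep {(m , m∈H) , (k , k∈S)} {(m′ , m′∈H) , (k′ , k′∈S)} e
    with m≡m′ , k≡k′ ← unique-sum sep m∈H k∈S m′∈H k′∈S e =
    cong₂ _,_ (Elem-≡ m≡m′) (Elem-≡ k≡k′)

  representative : ∀ {S a} (p : Pairs S) → sum p ≡ a → Σ (Fin n) λ s → s ∈ S × s ∼ a
  representative ((m , m∈H) , (s , s∈S)) refl = s , s∈S , ∼-sym (h⊕x∼x s m∈H)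

  section : ∀ {S} → Covers S → Fin n → Pairs S
  section cov a with s , s∈S , s∼a ← cov a = (a ⊖ s , ∼-sym s∼a) , (s , s∈S)

  sum∘section : ∀ {S} (cov : Covers S) a → sum (section cov a) ≡ a
  sum∘section cov a with s , _ , _ ← cov a = //-rightDividesˡ s a

  Fin↔Pairs : ∀ S → Fin (∣ H ∣ * ∣ S ∣) ↔ Pairs S
  Fin↔Pairs S = ↔-trans *↔× (Fin∣p∣↔Elem H ×-↔ Fin∣p∣↔Elem S)

  sumFin : ∀ S → Fin (∣ H ∣ * ∣ S ∣) → Fin n
  sumFin S = sum ∘ Inverse.to (Fin↔Pairs S)

  sumFin-injective : ∀ {S} → Separated S → Injective _≡_ _≡_ (sumFin S)
  sumFin-injective {S} sep = Injection.injective (↔⇒↣ (Fin↔Pairs S)) ∘ sum-injective sep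

  size : ∀ {S} → Separated S → Covers S → ∣ H ∣ * ∣ S ∣ ≡ n
  size {S} sep cov = cantor-schröder-bernstein (sumFin-injective sep) fromSection-injective
    where
    fromSection-injective : Injective _≡_ _≡_ (Inverse.from (Fin↔Pairs S) ∘ section cov)
    fromSection-injective {a} {b} e = begin
      a                   ≡⟨ sym (sum∘section cov a) ⟩
      sum (section cov a) ≡⟨ cong sum (Injection.injective (↔⇒↣ (↔-sym (Fin↔Pairs S))) e) ⟩
      sum (section cov b) ≡⟨ sum∘section cov b ⟩
      b                   ∎
      where open ≡-Reasoning

  size⇒covers : ∀ {S} → Separated S → ∣ H ∣ * ∣ S ∣ ≡ n → Covers S
  size⇒covers {S} sep |H||S|≡n a
    with i , sum≡a ← injective⇒surjective |H||S|≡n (sumFin S) (sumFin-injective sep) a =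
    representative (Inverse.to (Fin↔Pairs S) i) sum≡a

  T⁰-separated : ∀ {T} → (∀ {s s′} → s ∈ T → s′ ∈ T⁰ G T → s ∼ s′ → s ≡ s′) →
                 Separated (T⁰ G T)
  T⁰-separated {T} sepT s∈T⁰ s′∈T⁰ s∼s′ with T⁰-cases s∈T⁰ | T⁰-cases s′∈T⁰
  ... | inj₁ s∈T | _         = sepT s∈T s′∈T⁰ s∼s′
  ... | inj₂ _   | inj₁ s′∈T = sym (sepT s′∈T s∈T⁰ (∼-sym s∼s′))
  ... | inj₂ s≡𝟘 | inj₂ s′≡𝟘 = trans s≡𝟘 (sym s′≡𝟘)

  Avoids : Subset n → Set
  Avoids T = ∀ x → x ∈ H → (x ∈ T ⊎ InDiff G T x) → x ≡ 𝟘

  separated⇔avoids : ∀ {T} → Separated (T⁰ G T) ⇔ Avoids T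
  separated⇔avoids {T} = mk⇔ avoids (λ av → T⁰-separated (separated av))
    where
    avoids : Separated (T⁰ G T) → Avoids T
    avoids sep x x∈H (inj₁ x∈T) = sep (T⊆T⁰ x∈T) 𝟘∈T⁰ (∈H⇒∼𝟘 x∈H)
    avoids sep x x∈H (inj₂ (t , t′ , t∈T , t′∈T , x≡t⊖t′)) = begin
      x       ≡⟨ x≡t⊖t′ ⟩
      t ⊖ t′  ≡⟨ cong (_⊖ t′) (sep (T⊆T⁰ t∈T) (T⊆T⁰ t′∈T) (subst (_∈ H) x≡t⊖t′ x∈H)) ⟩
      t′ ⊖ t′ ≡⟨ inverseʳ t′ ⟩
      𝟘       ∎
      where open ≡-Reasoning
    separated : Avoids T → ∀ {s s′} → s ∈ T → s′ ∈ T⁰ G T → s ∼ s′ → s ≡ s′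
    separated av {s} {s′} s∈T s′∈T⁰ s∼s′ with T⁰-cases s′∈T⁰
    ... | inj₁ s′∈T = x∙y⁻¹≈ε⇒x≈y s s′ (av (s ⊖ s′) s∼s′ (inj₂ (s , s′ , s∈T , s′∈T , refl)))
    ... | inj₂ refl = av s (∼𝟘⇒∈H s∼s′) (inj₁ s∈T)

  module FromPerfectCode {T} (sf : SquareFree G T) (pc : IsPerfectCodeCayS G ⊤ T H) where
    dominator-unique : ∀ {v c c′} → c ∈ H → c′ ∈ H → Dist≤1 G T v c → Dist≤1 G T v c′ → c ≡ c′
    dominator-unique {v} c∈H c′∈H v~c v~c′ with pc v ∈⊤
    ... | _ , _ , _ , unique = trans (unique _ c∈H v~c) (sym (unique _ c′∈H v~c′))

    -- Every s′ ∈ T⁰ is dominated by 0, and by s − s′ whenever s ∈ T lies in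
    -- the coset of s′; so s − s′ = 0.
    separated : Separated (T⁰ G T)
    separated = T⁰-separated separatedT
      where
      𝟘-dominates : ∀ {s′} → s′ ∈ T⁰ G T → Dist≤1 G T s′ 𝟘
      𝟘-dominates {s′} s′∈T⁰ with T⁰-cases s′∈T⁰
      ... | inj₁ s′∈T = adjacent sf (subst (_∈ T) (sym (identityʳ s′)) s′∈T)
      ... | inj₂ s′≡𝟘 = inj₁ (sym s′≡𝟘)
      separatedT : ∀ {s s′} → s ∈ T → s′ ∈ T⁰ G T → s ∼ s′ → s ≡ s′
      separatedT {s} {s′} s∈T s′∈T⁰ s∼s′ = x∙y⁻¹≈ε⇒x≈y s s′
        (dominator-unique s∼s′ zero-mem
          (adjacent sf (subst (_∈ T) (sym (x⊕[y⊖x]≡y s′ s)) s∈T)) (𝟘-dominates s′∈T⁰))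

    covers : Covers (T⁰ G T)
    covers a with pc a ∈⊤
    ... | c , c∈H , inj₁ c≡a , _          = 𝟘 , 𝟘∈T⁰ , ∼-sym (∈H⇒∼𝟘 (subst (_∈ H) c≡a c∈H))
    ... | c , c∈H , inj₂ (_ , a⊕c∈T) , _ = a ⊕ c , T⊆T⁰ a⊕c∈T , x⊕h∼x a c∈H

  module ToPerfectCode {T} (sf : SquareFree G T) (sep : Separated (T⁰ G T)) (cov : Covers (T⁰ G T))
                       {B} (B≤A : IsSubgroup G B) (H⊆B : H ⊆ B) where
    T∩B⊆T : T ∩ B ⊆ T
    T∩B⊆T = proj₁ ∘ x∈p∩q⁻ T B

    squareFree : SquareFree G (T ∩ B)
    squareFree x x∈T∩B = sf x (T∩B⊆T x∈T∩B)

    squareFreeIn : SquareFreeIn G B (T ∩ B)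
    squareFreeIn x x∈T∩B (y , _ , x≡y⊕y) = squareFree x x∈T∩B (y , ∈⊤ , x≡y⊕y)

    -- H ∩ T = ∅: an element of both is in the coset of 0 ∈ T⁰, hence is 0.
    disjoint : ∀ {x} → x ∈ T → x ∉ H
    disjoint x∈T x∈H = 𝟘∉ sf (subst (_∈ T) (sep (T⊆T⁰ x∈T) 𝟘∈T⁰ (∈H⇒∼𝟘 x∈H)) x∈T)

    dominator-unique : ∀ {v c c′} → c ∈ H → c′ ∈ H →
                       Dist≤1 G (T ∩ B) v c → Dist≤1 G (T ∩ B) v c′ → c ≡ c′
    dominator-unique c∈H c′∈H (inj₁ c≡v) (inj₁ c′≡v) = trans c≡v (sym c′≡v)
    dominator-unique c∈H c′∈H (inj₁ refl) (inj₂ (_ , c⊕c′∈T∩B)) =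
      contradiction (add-mem c∈H c′∈H) (disjoint (T∩B⊆T c⊕c′∈T∩B))
    dominator-unique c∈H c′∈H (inj₂ (_ , c′⊕c∈T∩B)) (inj₁ refl) =
      contradiction (add-mem c′∈H c∈H) (disjoint (T∩B⊆T c′⊕c∈T∩B))
    dominator-unique {v} c∈H c′∈H (inj₂ (_ , v⊕c∈T∩B)) (inj₂ (_ , v⊕c′∈T∩B)) =
      ⊕-cancelˡ v (sep (T⊆T⁰ (T∩B⊆T v⊕c∈T∩B)) (T⊆T⁰ (T∩B⊆T v⊕c′∈T∩B))
                      (∼-trans (x⊕h∼x v c∈H) (∼-sym (x⊕h∼x v c′∈H))))

    -- The dominator of v comes from the representative s ∈ T⁰ of v + H.
    perfectCode : IsPerfectCodeCayS G B (T ∩ B) H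
    perfectCode v v∈B with s , s∈T⁰ , s∼v ← cov v | T⁰-cases s∈T⁰
    ... | inj₂ refl = v , v∈H , inj₁ refl , λ c′ c′∈H v~c′ → dominator-unique c′∈H v∈H v~c′ (inj₁ refl)
      where
      v∈H : v ∈ H
      v∈H = ∼𝟘⇒∈H (∼-sym s∼v)
    ... | inj₁ s∈T = s ⊖ v , s∼v , v~c , λ c′ c′∈H v~c′ → dominator-unique c′∈H s∼v v~c′ v~c
      where
      s∈B : s ∈ B
      s∈B = subst (_∈ B) (x⊕[y⊖x]≡y v s) (IsSubgroup.add-mem B≤A v∈B (H⊆B s∼v))
      v~c : Dist≤1 G (T ∩ B) v (s ⊖ v)
      v~c = adjacent squareFree (subst (_∈ T ∩ B) (sym (x⊕[y⊖x]≡y v s)) (x∈p∩q⁺ (s∈T , s∈B)))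

module Characterisations {n : ℕ} (G : FinAbGroup n) (H : Subset n) (H≤A : IsSubgroup G H) where
  open GroupFacts G
  open Cosets G H H≤A

  Representatives : Set
  Representatives = Σ (Subset n) λ T → SquareFree G T × Separated (T⁰ G T) × Covers (T⁰ G T)

  PerfectCodeOfEvery : Set
  PerfectCodeOfEvery = ∀ (B : Subset n) → IsSubgroup G B → H ⊆ B → SubgroupPerfectCodeOf G B H

  perfectCode⇒representatives : SubgroupPerfectCode G H → Representatives
  perfectCode⇒representatives (T , _ , sf , pc) = T , sf , (λ {_} {_} → separated) , covers
    where open FromPerfectCode sf pc

  representatives⇒perfectCodeOfEvery : Representatives → PerfectCodeOfEvery
  representatives⇒perfectCodeOfEvery (T , sf , sep , cov) B B≤A H⊆B =
    T ∩ B , proj₂ ∘ x∈p∩q⁻ T B , squareFreeIn , perfectCode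
    where open ToPerfectCode sf sep cov B≤A H⊆B

  perfectCodeOfEvery⇒perfectCode : PerfectCodeOfEvery → SubgroupPerfectCode G H
  perfectCodeOfEvery⇒perfectCode every = every ⊤ A≤A (λ _ → ∈⊤)
    where
    A≤A : IsSubgroup G ⊤
    A≤A = record { zero-mem = ∈⊤ ; add-mem = λ _ _ → ∈⊤ ; neg-mem = λ _ → ∈⊤ }

  perfectCode⇔representatives : SubgroupPerfectCode G H ⇔ Representatives
  perfectCode⇔representatives = mk⇔ perfectCode⇒representatives
    (perfectCodeOfEvery⇒perfectCode ∘ representatives⇒perfectCodeOfEvery)

  transversal⇔representatives : (Σ (Subset n) λ T → SquareFree G T × IsTransversal G H (T⁰ G T)) ⇔ Representatives
  transversal⇔representatives = Σ-⇔ (↠-id _) (⇔-id _ ×-⇔ transversal⇔separated×covers)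

  index⇔representatives : (Σ (Subset n) λ T → SquareFree G T × IndexIs G H (∣ T ∣ + 1) × Avoids T) ⇔ Representatives
  index⇔representatives = Σ-⇔ (↠-id _) λ {_} → Σ-⇔ (↠-id _) λ {sf} → mk⇔ (fromIndex sf) (toIndex sf)
    where
    |H||T⁰| : ∀ {T} → SquareFree G T → ∣ H ∣ * ∣ T⁰ G T ∣ ≡ ∣ H ∣ * (∣ T ∣ + 1)
    |H||T⁰| sf = cong (∣ H ∣ *_) (∣T⁰∣ sf)

    fromIndex : ∀ {T} → SquareFree G T → IndexIs G H (∣ T ∣ + 1) × Avoids T →
                Separated (T⁰ G T) × Covers (T⁰ G T)
    fromIndex {T} sf (index , av) = (λ {_} {_} → sep) , size⇒covers sep (trans (|H||T⁰| sf) (sym index))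
      where
      sep : Separated (T⁰ G T)
      sep = Equivalence.from separated⇔avoids av

    toIndex : ∀ {T} → SquareFree G T → Separated (T⁰ G T) × Covers (T⁰ G T) →
              IndexIs G H (∣ T ∣ + 1) × Avoids T
    toIndex sf (sep , cov) = trans (sym (size sep cov)) (|H||T⁰| sf) , Equivalence.to separated⇔avoids sep

  decomposition⇔representatives : (Σ (Subset n) λ T → SquareFree G T × DirectDecomp G H (T⁰ G T)) ⇔ Representatives
  decomposition⇔representatives = Σ-⇔ (↠-id _) (⇔-id _ ×-⇔ decomposition⇔separated×covers)

  perfectCodeOfEvery⇔representatives : PerfectCodeOfEvery ⇔ Representatives
  perfectCodeOfEvery⇔representatives =
    mk⇔ (perfectCode⇒representatives ∘ perfectCodeOfEvery⇒perfectCode) representatives⇒perfectCodeOfEvery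

proposition3p3 : ∀ {n : ℕ} (G : FinAbGroup n) → 2 ∣ n →
    (H : Subset n) → IsSubgroup G H →
    let open FinAbGroup G in
    (SubgroupPerfectCode G H ⇔
      (Σ (Subset n) λ T → SquareFree G T × IsTransversal G H (T⁰ G T)))
    × (SubgroupPerfectCode G H ⇔
      (Σ (Subset n) λ T → SquareFree G T × IndexIs G H (∣ T ∣ + 1) ×
        (∀ x → x ∈ H → (x ∈ T ⊎ InDiff G T x) → x ≡ 𝟘)))
    × (SubgroupPerfectCode G H ⇔
      (Σ (Subset n) λ T → SquareFree G T × DirectDecomp G H (T⁰ G T)))
    × (SubgroupPerfectCode G H ⇔
      (∀ (B : Subset n) → IsSubgroup G B → H ⊆ B → SubgroupPerfectCodeOf G B H))
proposition3p3 G _ H H≤A =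
  ⇔-sym transversal⇔representatives ⇔-∘ perfectCode⇔representatives ,
  ⇔-sym index⇔representatives ⇔-∘ perfectCode⇔representatives ,
  ⇔-sym decomposition⇔representatives ⇔-∘ perfectCode⇔representatives ,
  ⇔-sym perfectCodeOfEvery⇔representatives ⇔-∘ perfectCode⇔representatives
  where open Characterisations G H H≤A
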